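{- (a) Let $n\ge 6$ be even and $C_1$ as in the context. Then $\mathbf{1}^TC_1^{ -1}e^1=\mathbf{1}^TC_1^{ -1}e^2=1$; $\mathbf{1}^TC_1^{ -1}e^k=-F_{k-1}$ for odd $k$ with $3\le k\le n-3$; $\mathbf{1}^TC_1^{ -1}e^k=F_{k-1}$ for even $k$ with $4\le k\le n-2$; and $\mathbf{1}^TC_1^{ -1}e^{n-1}=F_{n-3}$. (b) Let $n\ge 7$ be odd and $C_2$ as in the context. Then $\mathbf{1}^TC_2^{ -1}e^1=\mathbf{1}^TC_2^{ -1}e^2=1$; $\mathbf{1}^TC_2^{ -1}e^k=-F_{k-1}$ for odd $k$ with $3\le k\le n-4$; $\mathbf{1}^TC_2^{ -1}e^k=F_{k-1}$ for even $k$ with $4\le k\le n-3$; and $\mathbf{1}^TC_2^{ -1}e^{n-2}=\mathbf{1}^TC_2^{ -1}e^{n-1}=F_{n-4}$.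
   Context: $F_m$ is the $m$-th Fibonacci number, $F_1=F_2=1$, $F_{m+1}=F_m+F_{m-1}$. $e^1,\dots,e^{n-1}$ are the standard basis vectors of $\mathbb{R}^{n-1}$ and $\mathbf{1}\in\mathbb{R}^{n-1}$ is the all-ones vector (so $\mathbf{1}^TMe^k$ is the $k$-th column sum of $M$). For even $n$, $C_1$ is the $(n-1)\times(n-1)$ matrix with $C_1e^1=e^1$, $C_1e^2=e^2$; for odd $k$ with $3\le k\le n-3$, $C_1e^k=e^1+\sum_{i=1}^{(k-1)/2}e^{2i}+e^k$; for even $k$ with $4\le k\le n-2$, $C_1e^k=\sum_{i=1}^{(k-2)/2}e^{2i+1}+e^k$; and $C_1e^{n-1}=\sum_{i=1}^{(n-4)/2}e^{2i+1}+e^{n-1}$. For odd $n$, $C_2$ is the $(n-1)\times(n-1)$ matrix with $C_2e^1=e^1$, $C_2e^2=e^2$; for odd $k$ with $3\le k\le n-4$, $C_2e^k=e^1+\sum_{i=1}^{(k-1)/2}e^{2i}+e^k$; for even $k$ with $4\le k\le n-3$, $C_2e^k=\sum_{i=1}^{(k-2)/2}e^{2i+1}+e^k$; $C_2e^{n-2}=\sum_{i=1}^{(n-5)/2}e^{2i+1}+e^{n-2}$ and $C_2e^{n-1}=\sum_{i=1}^{(n-5)/2}e^{2i+1}+e^{n-1}$. -}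

module Defs where

open import Data.Bool using (Bool; true; false; if_then_else_; _∧_; _∨_; not)
open import Data.Nat using (ℕ; zero; suc; _∸_; _≤ᵇ_; _≡ᵇ_)
open import Data.Nat.Divisibility using (_∣?_)
open import Data.Fin using (Fin; toℕ) renaming (zero to fz; suc to fs)
open import Data.Integer using (ℤ; 0ℤ; 1ℤ) renaming (_+_ to _+ℤ_; _*_ to _*ℤ_)
open import Relation.Nullary using (does)
open import Relation.Binary.PropositionalEquality using (_≡_)
open import Data.Product using (_×_)

fib : ℕ → ℕ
fib 0 = 0
fib 1 = 1
fib (suc (suc m)) = fib (suc m) Data.Nat.+ fib m

Matrix : ℕ → Set
Matrix m = Fin m → Fin m → ℤ

Σℤ : (m : ℕ) → (Fin m → ℤ) → ℤ
Σℤ zero f = 0ℤ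
Σℤ (suc m) f = f fz +ℤ Σℤ m (λ i → f (fs i))

_⊗_ : ∀ {m} → Matrix m → Matrix m → Matrix m
_⊗_ {m} A B i j = Σℤ m (λ l → A i l *ℤ B l j)

identity : ∀ {m} → Matrix m
identity {zero} ()
identity {suc m} fz fz = 1ℤ
identity {suc m} fz (fs j) = 0ℤ
identity {suc m} (fs i) fz = 0ℤ
identity {suc m} (fs i) (fs j) = identity {m} i j

IsInverse : ∀ {m} → Matrix m → Matrix m → Set
IsInverse C D = (∀ i j → (C ⊗ D) i j ≡ identity i j) × (∀ i j → (D ⊗ C) i j ≡ identity i j)

-- 1^T M e^k : the k-th column sum (k is 0-based as a Fin, i.e. column toℕ k + 1)
colSum : ∀ {m} → Matrix m → Fin m → ℤ
colSum {m} M k = Σℤ m (λ i → M i k)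

even : ℕ → Bool
even k = does (2 ∣? k)

odd : ℕ → Bool
odd k = not (even k)

b2z : Bool → ℤ
b2z true = 1ℤ
b2z false = 0ℤ

between : ℕ → ℕ → ℕ → Bool
between a i b = (a ≤ᵇ i) ∧ (i ≤ᵇ b)

-- entries of C₁ with 1-based row i and column k (n even)
c₁ : ℕ → ℕ → ℕ → Bool
c₁ n i k =
  if k ≡ᵇ 1 then i ≡ᵇ 1 else
  if k ≡ᵇ 2 then i ≡ᵇ 2 else
  if k ≡ᵇ (n ∸ 1) then ((odd i ∧ between 3 i (n ∸ 3)) ∨ (i ≡ᵇ (n ∸ 1))) else
  if odd k then ((i ≡ᵇ 1) ∨ (even i ∧ between 2 i (k ∸ 1)) ∨ (i ≡ᵇ k))
  else ((odd i ∧ between 3 i (k ∸ 1)) ∨ (i ≡ᵇ k))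

-- entries of C₂ with 1-based row i and column k (n odd)
c₂ : ℕ → ℕ → ℕ → Bool
c₂ n i k =
  if k ≡ᵇ 1 then i ≡ᵇ 1 else
  if k ≡ᵇ 2 then i ≡ᵇ 2 else
  if k ≡ᵇ (n ∸ 2) then ((odd i ∧ between 3 i (n ∸ 4)) ∨ (i ≡ᵇ (n ∸ 2))) else
  if k ≡ᵇ (n ∸ 1) then ((odd i ∧ between 3 i (n ∸ 4)) ∨ (i ≡ᵇ (n ∸ 1))) else
  if odd k then ((i ≡ᵇ 1) ∨ (even i ∧ between 2 i (k ∸ 1)) ∨ (i ≡ᵇ k))
  else ((odd i ∧ between 3 i (k ∸ 1)) ∨ (i ≡ᵇ k))

C₁ : (n : ℕ) → Matrix (n ∸ 1)
C₁ n i k = b2z (c₁ n (suc (toℕ i)) (suc (toℕ k)))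

C₂ : (n : ℕ) → Matrix (n ∸ 1)
C₂ n i k = b2z (c₂ n (suc (toℕ i)) (suc (toℕ k)))

module Submission where

-- Both matrices are upper unitriangular, hence invertible, and the column sums of any
-- inverse D of a matrix C are read off a left eigenvector: if rᵀC = 1ᵀ then
-- 1ᵀD = (rᵀC)D = rᵀ(CD) = rᵀ.  The eigenvector is r₁ = 1, r_x = (-1)ˣ F_{x-1} on the leading
-- rows and the constant F_{L-2} on the trailing rows x ≥ L, and rᵀC = 1ᵀ comes down to two
-- Fibonacci partial-sum identities, one per column shape.

open import Defs
open import Data.Bool using (Bool; true; false; if_then_else_; _∧_; _∨_; not)
open import Data.Bool.Properties using (∨-zeroʳ; ∧-zeroʳ; ¬-not; not-involutive; T-≡)
open import Data.Nat using (ℕ; zero; suc; _∸_; _≤_; _<_; z≤n; s≤s; z<s; _≤ᵇ_; _≡ᵇ_; _≤′_; ≤′-refl; ≤′-step)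
import Data.Nat.Properties as ℕ
open import Data.Nat.Divisibility using (_∣_; _∣?_; ∣-refl; ∣m+n∣m⇒∣n; ∣m∣n⇒∣m+n)
open import Data.Fin using (Fin; toℕ) renaming (zero to fz; suc to fs)
open import Data.Fin.Properties using (toℕ<n)
open import Data.Integer using (ℤ; 0ℤ; 1ℤ; +_; -_; _+_; _*_)
open import Data.Integer.Properties
  using (+-assoc; +-identityˡ; +-identityʳ; *-zeroʳ; *-identityˡ; *-identityʳ; pos-+; neg-distrib-+; neg-distribˡ-*)
open import Data.Integer.Tactic.RingSolver using (solve-∀)
open import Data.Product using (_×_; _,_; ∃; proj₁; proj₂)
open import Data.Sum using (inj₁; inj₂)
open import Function.Bundles using (Equivalence)
open import Relation.Nullary using (¬_; yes; no)
open import Relation.Nullary.Decidable using (dec-true; dec-false)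
open import Relation.Binary.PropositionalEquality
open ≡-Reasoning

Σ-cong : ∀ m {f g : Fin m → ℤ} → (∀ i → f i ≡ g i) → Σℤ m f ≡ Σℤ m g
Σ-cong zero    f≗g = refl
Σ-cong (suc m) f≗g = cong₂ _+_ (f≗g fz) (Σ-cong m (λ i → f≗g (fs i)))

Σ-zero : ∀ m {f : Fin m → ℤ} → (∀ i → f i ≡ 0ℤ) → Σℤ m f ≡ 0ℤ
Σ-zero zero    f≗0 = refl
Σ-zero (suc m) f≗0 = cong₂ _+_ (f≗0 fz) (Σ-zero m (λ i → f≗0 (fs i)))

Σ-+ : ∀ m (f g : Fin m → ℤ) → Σℤ m (λ i → f i + g i) ≡ Σℤ m f + Σℤ m g
Σ-+ zero    f g = refl
Σ-+ (suc m) f g = begin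
  f fz + g fz + Σℤ m (λ i → f (fs i) + g (fs i))
    ≡⟨ cong (λ s → f fz + g fz + s) (Σ-+ m (λ i → f (fs i)) (λ i → g (fs i))) ⟩
  f fz + g fz + (Σℤ m (λ i → f (fs i)) + Σℤ m (λ i → g (fs i)))
    ≡⟨ interchange (f fz) (g fz) _ _ ⟩
  f fz + Σℤ m (λ i → f (fs i)) + (g fz + Σℤ m (λ i → g (fs i))) ∎
  where
  interchange : ∀ a b c d → a + b + (c + d) ≡ a + c + (b + d)
  interchange = solve-∀

Σ-*ˡ : ∀ m c (f : Fin m → ℤ) → Σℤ m (λ i → c * f i) ≡ c * Σℤ m f
Σ-*ˡ zero    c f = sym (*-zeroʳ c)
Σ-*ˡ (suc m) c f = begin
  c * f fz + Σℤ m (λ i → c * f (fs i)) ≡⟨ cong (λ s → c * f fz + s) (Σ-*ˡ m c (λ i → f (fs i))) ⟩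
  c * f fz + c * Σℤ m (λ i → f (fs i)) ≡⟨ distrib c (f fz) _ ⟩
  c * (f fz + Σℤ m (λ i → f (fs i)))   ∎
  where
  distrib : ∀ a b d → a * b + a * d ≡ a * (b + d)
  distrib = solve-∀

Σ-*ʳ : ∀ m c (f : Fin m → ℤ) → Σℤ m (λ i → f i * c) ≡ Σℤ m f * c
Σ-*ʳ zero    c f = refl
Σ-*ʳ (suc m) c f = begin
  f fz * c + Σℤ m (λ i → f (fs i) * c) ≡⟨ cong (λ s → f fz * c + s) (Σ-*ʳ m c (λ i → f (fs i))) ⟩
  f fz * c + Σℤ m (λ i → f (fs i)) * c ≡⟨ distrib c (f fz) _ ⟩
  (f fz + Σℤ m (λ i → f (fs i))) * c   ∎
  where
  distrib : ∀ a b d → b * a + d * a ≡ (b + d) * a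
  distrib = solve-∀

Σ-neg : ∀ m (f : Fin m → ℤ) → Σℤ m (λ i → - f i) ≡ - Σℤ m f
Σ-neg zero    f = refl
Σ-neg (suc m) f = trans (cong (λ s → - f fz + s) (Σ-neg m (λ i → f (fs i)))) (sym (neg-distrib-+ (f fz) _))

Σ-swap : ∀ m p (f : Fin m → Fin p → ℤ) →
         Σℤ m (λ i → Σℤ p (λ j → f i j)) ≡ Σℤ p (λ j → Σℤ m (λ i → f i j))
Σ-swap zero    p f = sym (Σ-zero p (λ _ → refl))
Σ-swap (suc m) p f = begin
  Σℤ p (f fz) + Σℤ m (λ i → Σℤ p (f (fs i)))  ≡⟨ cong (λ s → Σℤ p (f fz) + s) (Σ-swap m p (λ i → f (fs i))) ⟩
  Σℤ p (f fz) + Σℤ p (λ j → Σℤ m (λ i → f (fs i) j)) ≡⟨ sym (Σ-+ p (f fz) _) ⟩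
  Σℤ p (λ j → f fz j + Σℤ m (λ i → f (fs i) j)) ∎

_ᵀ⊗_ : ∀ {m} → (Fin m → ℤ) → Matrix m → Fin m → ℤ
_ᵀ⊗_ {m} u A j = Σℤ m (λ p → u p * A p j)

ᵀ⊗-congʳ : ∀ {m} (u : Fin m → ℤ) (A B : Matrix m) j →
           (∀ p → A p j ≡ B p j) → (u ᵀ⊗ A) j ≡ (u ᵀ⊗ B) j
ᵀ⊗-congʳ {m} u A B j A≗B = Σ-cong m (λ p → cong (u p *_) (A≗B p))

ᵀ⊗-identity : ∀ {m} (u : Fin m → ℤ) j → (u ᵀ⊗ identity) j ≡ u j
ᵀ⊗-identity {suc m} u fz = begin
  u fz * 1ℤ + Σℤ m (λ p → u (fs p) * 0ℤ) ≡⟨ cong (λ s → u fz * 1ℤ + s) (Σ-zero m (λ p → *-zeroʳ (u (fs p)))) ⟩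
  u fz * 1ℤ + 0ℤ                         ≡⟨ +-identityʳ _ ⟩
  u fz * 1ℤ                              ≡⟨ *-identityʳ _ ⟩
  u fz                                   ∎
ᵀ⊗-identity {suc m} u (fs j) = begin
  u fz * 0ℤ + ((λ p → u (fs p)) ᵀ⊗ identity) j ≡⟨ cong₂ _+_ (*-zeroʳ (u fz)) (ᵀ⊗-identity (λ p → u (fs p)) j) ⟩
  0ℤ + u (fs j)                                 ≡⟨ +-identityˡ _ ⟩
  u (fs j)                                      ∎

ᵀ⊗-assoc : ∀ {m} (u : Fin m → ℤ) (A B : Matrix m) j → ((u ᵀ⊗ A) ᵀ⊗ B) j ≡ (u ᵀ⊗ (A ⊗ B)) j
ᵀ⊗-assoc {m} u A B j = begin
  Σℤ m (λ l → Σℤ m (λ p → u p * A p l) * B l j)  ≡⟨ Σ-cong m (λ l → sym (Σ-*ʳ m (B l j) _)) ⟩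
  Σℤ m (λ l → Σℤ m (λ p → u p * A p l * B l j))  ≡⟨ Σ-swap m m _ ⟩
  Σℤ m (λ p → Σℤ m (λ l → u p * A p l * B l j))  ≡⟨ Σ-cong m (λ p → Σ-cong m (λ l → *-assoc₃ (u p) _ _)) ⟩
  Σℤ m (λ p → Σℤ m (λ l → u p * (A p l * B l j))) ≡⟨ Σ-cong m (λ p → Σ-*ˡ m (u p) _) ⟩
  Σℤ m (λ p → u p * (A ⊗ B) p j)                 ∎
  where
  *-assoc₃ : ∀ a b c → a * b * c ≡ a * (b * c)
  *-assoc₃ = solve-∀

ᵀ⊗-neg : ∀ {m} (u : Fin m → ℤ) (A : Matrix m) j → ((λ p → - u p) ᵀ⊗ A) j ≡ - (u ᵀ⊗ A) j
ᵀ⊗-neg {m} u A j = trans (Σ-cong m (λ p → sym (neg-distribˡ-* (u p) (A p j)))) (Σ-neg m _)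

-- The inverse is built by induction on
-- the size: writing C = [1 u; 0 C'] and D' for an inverse of C', the matrix
-- D = [1 -uD'; 0 D'] is a two-sided inverse of C.

UpperUnitriangular : ∀ {m} → Matrix m → Set
UpperUnitriangular C = (∀ i → C i i ≡ 1ℤ) × (∀ i j → toℕ j < toℕ i → C i j ≡ 0ℤ)

unitriangular-invertible : ∀ m (C : Matrix m) → UpperUnitriangular C → ∃ λ D → IsInverse C D
unitriangular-invertible zero    C _ = (λ ()) , (λ ()) , (λ ())
unitriangular-invertible (suc m) C (diag , lower) = D , CD≡I , DC≡I
  where
  u : Fin m → ℤ
  u j = C fz (fs j)
  C' : Matrix m
  C' i j = C (fs i) (fs j)
  inverse' : ∃ λ D' → IsInverse C' D'
  inverse' = unitriangular-invertible m C' ((λ i → diag (fs i)) , (λ i j j<i → lower (fs i) (fs j) (s≤s j<i)))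
  D' : Matrix m
  D' = proj₁ inverse'
  C'D'≡I : ∀ i j → (C' ⊗ D') i j ≡ identity i j
  C'D'≡I = proj₁ (proj₂ inverse')
  D'C'≡I : ∀ i j → (D' ⊗ C') i j ≡ identity i j
  D'C'≡I = proj₂ (proj₂ inverse')

  D : Matrix (suc m)
  D fz     fz     = 1ℤ
  D fz     (fs j) = - (u ᵀ⊗ D') j
  D (fs i) fz     = 0ℤ
  D (fs i) (fs j) = D' i j

  first-column-zero : ∀ i → C (fs i) fz ≡ 0ℤ
  first-column-zero i = lower (fs i) fz (s≤s z≤n)

  Σ-times-zero : ∀ (f : Fin m → ℤ) → Σℤ m (λ l → f l * 0ℤ) ≡ 0ℤ
  Σ-times-zero f = Σ-zero m (λ l → *-zeroʳ (f l))

  CD≡I : ∀ i j → (C ⊗ D) i j ≡ identity i j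
  CD≡I fz fz rewrite diag fz | Σ-times-zero u = refl
  CD≡I fz (fs j) rewrite diag fz = cancel ((u ᵀ⊗ D') j)
    where
    cancel : ∀ a → 1ℤ * - a + a ≡ 0ℤ
    cancel = solve-∀
  CD≡I (fs i) fz rewrite first-column-zero i | Σ-times-zero (C' i) = refl
  CD≡I (fs i) (fs j) rewrite first-column-zero i = trans (+-identityˡ _) (C'D'≡I i j)

  DC≡I : ∀ i j → (D ⊗ C) i j ≡ identity i j
  DC≡I fz fz rewrite diag fz
    | Σ-zero m (λ l → trans (cong (D fz (fs l) *_) (first-column-zero l)) (*-zeroʳ (D fz (fs l)))) = refl
  DC≡I fz (fs j) = begin
    1ℤ * u j + ((λ l → - (u ᵀ⊗ D') l) ᵀ⊗ C') j ≡⟨ cong (λ s → 1ℤ * u j + s) (ᵀ⊗-neg (u ᵀ⊗ D') C' j) ⟩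
    1ℤ * u j + - ((u ᵀ⊗ D') ᵀ⊗ C') j          ≡⟨ cong (λ s → 1ℤ * u j + - s) (ᵀ⊗-assoc u D' C' j) ⟩
    1ℤ * u j + - (u ᵀ⊗ (D' ⊗ C')) j           ≡⟨ cong (λ s → 1ℤ * u j + - s) (ᵀ⊗-congʳ u (D' ⊗ C') identity j (λ p → D'C'≡I p j)) ⟩
    1ℤ * u j + - (u ᵀ⊗ identity) j            ≡⟨ cong (λ s → 1ℤ * u j + - s) (ᵀ⊗-identity u j) ⟩
    1ℤ * u j + - u j                          ≡⟨ cancel (u j) ⟩
    0ℤ                                        ∎
    where
    cancel : ∀ a → 1ℤ * a + - a ≡ 0ℤ
    cancel = solve-∀
  DC≡I (fs i) fz
    rewrite Σ-zero m (λ l → trans (cong (D' i l *_) (first-column-zero l)) (*-zeroʳ (D' i l))) = refl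
  DC≡I (fs i) (fs j) = trans (+-identityˡ _) (D'C'≡I i j)

colSum-right-inverse : ∀ {m} (C D : Matrix m) (r : Fin m → ℤ) →
  (∀ i j → (C ⊗ D) i j ≡ identity i j) → (∀ i → (r ᵀ⊗ C) i ≡ 1ℤ) →
  ∀ k → colSum D k ≡ r k
colSum-right-inverse {m} C D r CD≡I rC≡1 k = begin
  Σℤ m (λ i → D i k)               ≡⟨ Σ-cong m (λ i → sym (trans (cong (_* D i k) (rC≡1 i)) (*-identityˡ _))) ⟩
  ((r ᵀ⊗ C) ᵀ⊗ D) k                ≡⟨ ᵀ⊗-assoc r C D k ⟩
  (r ᵀ⊗ (C ⊗ D)) k                 ≡⟨ ᵀ⊗-congʳ r (C ⊗ D) identity k (λ p → CD≡I p k) ⟩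
  (r ᵀ⊗ identity) k                ≡⟨ ᵀ⊗-identity r k ⟩
  r k                              ∎

sumTo : ℕ → (ℕ → ℤ) → ℤ
sumTo zero    g = 0ℤ
sumTo (suc m) g = sumTo m g + g (suc m)

sumTo-first : ∀ m g → sumTo (suc m) g ≡ g 1 + sumTo m (λ x → g (suc x))
sumTo-first zero    g = trans (+-identityˡ (g 1)) (sym (+-identityʳ (g 1)))
sumTo-first (suc m) g = begin
  sumTo (suc m) g + g (suc (suc m))                     ≡⟨ cong (λ s → s + g (suc (suc m))) (sumTo-first m g) ⟩
  g 1 + sumTo m (λ x → g (suc x)) + g (suc (suc m))     ≡⟨ +-assoc (g 1) _ _ ⟩
  g 1 + (sumTo m (λ x → g (suc x)) + g (suc (suc m)))   ∎

Σℤ≡sumTo : ∀ m g → Σℤ m (λ j → g (suc (toℕ j))) ≡ sumTo m g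
Σℤ≡sumTo zero    g = refl
Σℤ≡sumTo (suc m) g = trans (cong (λ s → g 1 + s) (Σℤ≡sumTo m (λ x → g (suc x)))) (sym (sumTo-first m g))

sumTo-cong : ∀ m {f g : ℕ → ℤ} → (∀ x → 1 ≤ x → x ≤ m → f x ≡ g x) → sumTo m f ≡ sumTo m g
sumTo-cong zero    f≗g = refl
sumTo-cong (suc m) f≗g =
  cong₂ _+_ (sumTo-cong m (λ x 1≤x x≤m → f≗g x 1≤x (ℕ.m≤n⇒m≤1+n x≤m))) (f≗g (suc m) (s≤s z≤n) ℕ.≤-refl)

sumTo-truncate : ∀ {b m} (f : ℕ → ℤ) → b ≤ m → (∀ x → b < x → x ≤ m → f x ≡ 0ℤ) → sumTo m f ≡ sumTo b f
sumTo-truncate f b≤m = go (ℕ.≤⇒≤′ b≤m)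
  where
  go : ∀ {b m} → b ≤′ m → (∀ x → b < x → x ≤ m → f x ≡ 0ℤ) → sumTo m f ≡ sumTo b f
  go ≤′-refl             _   = refl
  go {b} (≤′-step {m} b≤′m) f≡0 = begin
    sumTo m f + f (suc m) ≡⟨ cong (λ s → sumTo m f + s) (f≡0 (suc m) (s≤s (ℕ.≤′⇒≤ b≤′m)) ℕ.≤-refl) ⟩
    sumTo m f + 0ℤ        ≡⟨ +-identityʳ _ ⟩
    sumTo m f             ≡⟨ go b≤′m (λ x b<x x≤m → f≡0 x b<x (ℕ.m≤n⇒m≤1+n x≤m)) ⟩
    sumTo b f             ∎

even-suc-suc : ∀ k → even (suc (suc k)) ≡ even k
even-suc-suc k with 2 ∣? k
... | yes 2∣k = trans (dec-true (2 ∣? suc (suc k)) (∣m∣n⇒∣m+n ∣-refl 2∣k)) (sym (dec-true (2 ∣? k) 2∣k))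
... | no  2∤k = trans (dec-false (2 ∣? suc (suc k)) (λ 2∣k+2 → 2∤k (∣m+n∣m⇒∣n 2∣k+2 ∣-refl)))
                      (sym (dec-false (2 ∣? k) 2∤k))

even-∸2 : ∀ {k} → 2 ≤ k → even (k ∸ 2) ≡ even k
even-∸2 {suc (suc k)} (s≤s (s≤s _)) = sym (even-suc-suc k)

even-suc : ∀ k → even (suc k) ≡ not (even k)
even-suc zero          = refl
even-suc (suc zero)    = refl
even-suc (suc (suc k)) = begin
  even (suc (suc (suc k))) ≡⟨ even-suc-suc (suc k) ⟩
  even (suc k)             ≡⟨ even-suc k ⟩
  not (even k)             ≡⟨ cong not (sym (even-suc-suc k)) ⟩
  not (even (suc (suc k))) ∎

even-suc-inv : ∀ m {b} → even (suc m) ≡ b → even m ≡ not b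
even-suc-inv m {b} eq = begin
  even m             ≡⟨ sym (not-involutive (even m)) ⟩
  not (not (even m)) ≡⟨ cong not (sym (even-suc m)) ⟩
  not (even (suc m)) ≡⟨ cong not eq ⟩
  not b              ∎

if-true : ∀ {A : Set} {b} {x y : A} → b ≡ true → (if b then x else y) ≡ x
if-true refl = refl

if-false : ∀ {A : Set} {b} {x y : A} → b ≡ false → (if b then x else y) ≡ y
if-false refl = refl

≡⇒≡ᵇ-true : ∀ {m n} → m ≡ n → (m ≡ᵇ n) ≡ true
≡⇒≡ᵇ-true {m} {n} m≡n = Equivalence.to T-≡ (ℕ.≡⇒≡ᵇ m n m≡n)

≡ᵇ-refl : ∀ m → (m ≡ᵇ m) ≡ true
≡ᵇ-refl m = ≡⇒≡ᵇ-true {m} refl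

≢⇒≡ᵇ-false : ∀ {m n} → m ≢ n → (m ≡ᵇ n) ≡ false
≢⇒≡ᵇ-false {m} {n} m≢n = ¬-not (λ eq → m≢n (ℕ.≡ᵇ⇒≡ m n (Equivalence.from T-≡ eq)))

≤⇒≤ᵇ-true : ∀ {m n} → m ≤ n → (m ≤ᵇ n) ≡ true
≤⇒≤ᵇ-true m≤n = Equivalence.to T-≡ (ℕ.≤⇒≤ᵇ m≤n)

>⇒≤ᵇ-false : ∀ {m n} → n < m → (m ≤ᵇ n) ≡ false
>⇒≤ᵇ-false {m} {n} n<m = ¬-not (λ eq → ℕ.<⇒≱ n<m (ℕ.≤ᵇ⇒≤ m n (Equivalence.from T-≡ eq)))

signedFib : ℕ → ℤ
signedFib zero                = 0ℤ
signedFib (suc zero)          = 1ℤ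
signedFib x@(suc (suc t)) = if even x then + fib (suc t) else - (+ fib (suc t))

-- The two Fibonacci partial-sum identities behind the whole computation:
--   1 + F₁ + F₃ + ⋯ + F_{m-1} = 1 + F_m      (m even, m ≥ 2),
--   F_b - (F₂ + F₄ + ⋯ + F_{b-1}) = 1         (b odd),
-- written as sums over 1 … m of the row contributions of the two column shapes below.

-- What row x contributes to an r-weighted fan column above its diagonal.
fanTerm : ℕ → ℤ
fanTerm (suc zero) = 1ℤ
fanTerm x          = if even x then + fib (x ∸ 1) else 0ℤ

-- What row x contributes to an r-weighted comb column up to its last odd row.
combTerm : ℕ → ℤ
combTerm x = if even x then 0ℤ else - (+ fib (x ∸ 1))

fanTerm-sum : ∀ m → 1 ≤ m → even m ≡ true → sumTo m fanTerm ≡ 1ℤ + + fib m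
fanTerm-sum (suc zero)                   _   ()
fanTerm-sum (suc (suc zero))             _   _  = refl
fanTerm-sum (suc (suc (suc zero)))       _   ()
fanTerm-sum (suc (suc m@(suc (suc _)))) _ ev = begin
  sumTo m fanTerm + fanTerm (suc m) + fanTerm (suc (suc m))
    ≡⟨ cong₂ _+_ (cong₂ _+_ (fanTerm-sum m (s≤s z≤n) m-even) odd-row) even-row ⟩
  1ℤ + + fib m + 0ℤ + + fib (suc m)
    ≡⟨ regroup (+ fib (suc m)) (+ fib m) ⟩
  1ℤ + (+ fib (suc m) + + fib m)
    ≡⟨ cong (λ s → 1ℤ + s) (sym (pos-+ (fib (suc m)) (fib m))) ⟩
  1ℤ + + fib (suc (suc m)) ∎
  where
  m-even : even m ≡ true
  m-even = trans (sym (even-suc-suc m)) ev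
  odd-row : fanTerm (suc m) ≡ 0ℤ
  odd-row = if-false (trans (even-suc m) (cong not m-even))
  even-row : fanTerm (suc (suc m)) ≡ + fib (suc m)
  even-row = if-true ev
  regroup : ∀ p q → 1ℤ + q + 0ℤ + p ≡ 1ℤ + (p + q)
  regroup = solve-∀

combTerm-sum : ∀ b → even b ≡ false → sumTo b combTerm + + fib b ≡ 1ℤ
combTerm-sum zero                      ()
combTerm-sum (suc zero)                _  = refl
combTerm-sum (suc (suc zero))          ()
combTerm-sum (suc (suc b@(suc _))) odd = begin
  sumTo b combTerm + combTerm (suc b) + combTerm (suc (suc b)) + + fib (suc (suc b))
    ≡⟨ cong₂ _+_ (cong₂ _+_ (cong (λ s → sumTo b combTerm + s) even-row) odd-row) (pos-+ (fib (suc b)) (fib b)) ⟩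
  sumTo b combTerm + 0ℤ + - (+ fib (suc b)) + (+ fib (suc b) + + fib b)
    ≡⟨ cancel (sumTo b combTerm) (+ fib (suc b)) (+ fib b) ⟩
  sumTo b combTerm + + fib b
    ≡⟨ combTerm-sum b b-odd ⟩
  1ℤ ∎
  where
  b-odd : even b ≡ false
  b-odd = trans (sym (even-suc-suc b)) odd
  even-row : combTerm (suc b) ≡ 0ℤ
  even-row = if-true (trans (even-suc b) (cong not b-odd))
  odd-row : combTerm (suc (suc b)) ≡ - (+ fib (suc b))
  odd-row = if-false odd
  cancel : ∀ s p q → s + 0ℤ + - p + (p + q) ≡ s + q
  cancel = solve-∀

fan : ℕ → ℕ → Bool
fan k x = (x ≡ᵇ 1) ∨ (even x ∧ between 2 x (k ∸ 1)) ∨ (x ≡ᵇ k)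

comb : ℕ → ℕ → ℕ → Bool
comb b k x = (odd x ∧ between 3 x b) ∨ (x ≡ᵇ k)

fan-diag : ∀ k → fan k k ≡ true
fan-diag k rewrite ≡ᵇ-refl k | ∨-zeroʳ (even k ∧ between 2 k (k ∸ 1)) = ∨-zeroʳ (k ≡ᵇ 1)

fan-below : ∀ {k x} → 1 ≤ k → k < x → fan k x ≡ false
fan-below {k} {x} 1≤k k<x
  rewrite ≢⇒≡ᵇ-false {x} {1} (ℕ.>⇒≢ (ℕ.≤-<-trans 1≤k k<x)) | ≢⇒≡ᵇ-false (ℕ.>⇒≢ k<x)
        | >⇒≤ᵇ-false (ℕ.≤-<-trans (ℕ.m∸n≤m k 1) k<x) | ∧-zeroʳ (2 ≤ᵇ x) | ∧-zeroʳ (even x) = refl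

fan-above : ∀ {k x} → 1 ≤ x → x < k → signedFib x * b2z (fan k x) ≡ fanTerm x
fan-above {k} {suc zero}        _ _   = refl
fan-above {k} {x@(suc (suc t))} _ x<k
  rewrite ≢⇒≡ᵇ-false (ℕ.<⇒≢ x<k) | ≤⇒≤ᵇ-true (ℕ.<⇒≤pred x<k) with even x
... | true  = *-identityʳ (+ fib (suc t))
... | false = *-zeroʳ (- (+ fib (suc t)))

comb-diag : ∀ b k → comb b k k ≡ true
comb-diag b k rewrite ≡ᵇ-refl k = ∨-zeroʳ (odd k ∧ between 3 k b)

comb-off : ∀ {b k x} → b < x → x ≢ k → comb b k x ≡ false
comb-off {b} {k} {x} b<x x≢k
  rewrite ≢⇒≡ᵇ-false x≢k | >⇒≤ᵇ-false b<x | ∧-zeroʳ (3 ≤ᵇ x) | ∧-zeroʳ (odd x) = refl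

comb-above : ∀ {b k x} → 1 ≤ x → x ≤ b → b < k → signedFib x * b2z (comb b k x) ≡ combTerm x
comb-above {b} {k} {suc zero} _ 1≤b b<k rewrite ≢⇒≡ᵇ-false {1} {k} (ℕ.<⇒≢ (ℕ.≤-<-trans 1≤b b<k)) = refl
comb-above {b} {k} {suc (suc zero)} _ 2≤b b<k rewrite ≢⇒≡ᵇ-false {2} {k} (ℕ.<⇒≢ (ℕ.≤-<-trans 2≤b b<k)) = refl
comb-above {b} {k} {x@(suc (suc (suc t)))} _ x≤b b<k
  rewrite ≢⇒≡ᵇ-false (ℕ.<⇒≢ (ℕ.≤-<-trans x≤b b<k)) | ≤⇒≤ᵇ-true x≤b with even x
... | true  = *-zeroʳ (+ fib (suc (suc t)))
... | false = *-identityʳ (- (+ fib (suc (suc t))))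

-- Column sums of the two shapes against a weight vector w that agrees with r above the
-- diagonal: an odd fan column k ≥ 3 with w_k = -F_{k-1} sums to (1 + F_{k-1}) - F_{k-1} = 1,
-- a comb column with w_k = F_b sums to -(F₂ + F₄ + ⋯ + F_{b-1}) + F_b = 1.

fan-column-sum : ∀ (w : ℕ → ℤ) k → 3 ≤ k → even k ≡ false →
  (∀ x → 1 ≤ x → x < k → w x ≡ signedFib x) → w k ≡ - (+ fib (k ∸ 1)) →
  sumTo k (λ x → w x * b2z (fan k x)) ≡ 1ℤ
fan-column-sum w (suc m) (s≤s 2≤m) odd w≡r wk = begin
  sumTo m f + w (suc m) * b2z (fan (suc m) (suc m))
    ≡⟨ cong₂ _+_ (sumTo-cong m above) (cong₂ (λ v e → v * b2z e) wk (fan-diag (suc m))) ⟩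
  sumTo m fanTerm + - (+ fib m) * 1ℤ
    ≡⟨ cong (λ s → s + - (+ fib m) * 1ℤ) (fanTerm-sum m (ℕ.≤-trans (s≤s z≤n) 2≤m) (even-suc-inv m odd)) ⟩
  1ℤ + + fib m + - (+ fib m) * 1ℤ
    ≡⟨ cancel (+ fib m) ⟩
  1ℤ ∎
  where
  f : ℕ → ℤ
  f x = w x * b2z (fan (suc m) x)
  above : ∀ x → 1 ≤ x → x ≤ m → f x ≡ fanTerm x
  above x 1≤x x≤m = trans (cong (λ v → v * b2z (fan (suc m) x)) (w≡r x 1≤x (s≤s x≤m))) (fan-above 1≤x (s≤s x≤m))
  cancel : ∀ p → 1ℤ + p + - p * 1ℤ ≡ 1ℤ
  cancel = solve-∀

comb-column-sum : ∀ (w : ℕ → ℤ) b k → even b ≡ false → b < k →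
  (∀ x → 1 ≤ x → x ≤ b → w x ≡ signedFib x) → w k ≡ + fib b →
  sumTo k (λ x → w x * b2z (comb b k x)) ≡ 1ℤ
comb-column-sum w b (suc m) odd (s≤s b≤m) w≡r wk = begin
  sumTo m f + w (suc m) * b2z (comb b (suc m) (suc m))
    ≡⟨ cong₂ _+_ (sumTo-truncate f b≤m gap) (cong₂ (λ v e → v * b2z e) wk (comb-diag b (suc m))) ⟩
  sumTo b f + + fib b * 1ℤ
    ≡⟨ cong₂ _+_ (sumTo-cong b above) (*-identityʳ (+ fib b)) ⟩
  sumTo b combTerm + + fib b
    ≡⟨ combTerm-sum b odd ⟩
  1ℤ ∎
  where
  f : ℕ → ℤ
  f x = w x * b2z (comb b (suc m) x)
  gap : ∀ x → b < x → x ≤ m → f x ≡ 0ℤ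
  gap x b<x x≤m = trans (cong (λ e → w x * b2z e) (comb-off b<x (ℕ.<⇒≢ (s≤s x≤m)))) (*-zeroʳ (w x))
  above : ∀ x → 1 ≤ x → x ≤ b → f x ≡ combTerm x
  above x 1≤x x≤b = trans (cong (λ v → v * b2z (comb b (suc m) x)) (w≡r x 1≤x x≤b)) (comb-above 1≤x x≤b (s≤s b≤m))

-- The column pattern shared by C₁ and C₂ (rows x and columns k numbered from 1), with L the
-- first of the trailing columns (L = n-1 for C₁, L = n-2 for C₂): columns 1 and 2 are unit
-- vectors, an odd column 3 ≤ k < L is a fan, an even column 4 ≤ k < L is a comb with b = k-1,
-- and every column k ≥ L is a comb with b = L-2.

entry : ℕ → ℕ → ℕ → Bool
entry L x zero                    = false
entry L x (suc zero)              = x ≡ᵇ 1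
entry L x (suc (suc zero))        = x ≡ᵇ 2
entry L x k@(suc (suc (suc _))) =
  if L ≤ᵇ k then comb (L ∸ 2) k x else if even k then comb (k ∸ 1) k x else fan k x

weight : ℕ → ℕ → ℤ
weight L x = if L ≤ᵇ x then + fib (L ∸ 2) else signedFib x

weight-below : ∀ {L x} → x < L → weight L x ≡ signedFib x
weight-below x<L = if-false (>⇒≤ᵇ-false x<L)

weight-from : ∀ {L x} → L ≤ x → weight L x ≡ + fib (L ∸ 2)
weight-from L≤x = if-true (≤⇒≤ᵇ-true L≤x)

data ColumnKind (L k : ℕ) : Set where
  trailing : L ≤ k → (∀ x → entry L x k ≡ comb (L ∸ 2) k x) → ColumnKind L k
  evenCol  : k < L → even k ≡ true → (∀ x → entry L x k ≡ comb (k ∸ 1) k x) → ColumnKind L k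
  oddCol   : k < L → even k ≡ false → (∀ x → entry L x k ≡ fan k x) → ColumnKind L k

columnKind : ∀ L k → 3 ≤ k → ColumnKind L k
columnKind L k (s≤s (s≤s (s≤s _))) with L ℕ.≤? k | even k in k-parity
... | yes L≤k | _     = trailing L≤k (λ x → if-true (≤⇒≤ᵇ-true L≤k))
... | no  L≰k | true  = evenCol k<L k-parity (λ x → trans (if-false (>⇒≤ᵇ-false k<L)) (if-true k-parity))
  where k<L = ℕ.≰⇒> L≰k
... | no  L≰k | false = oddCol k<L k-parity (λ x → trans (if-false (>⇒≤ᵇ-false k<L)) (if-false k-parity))
  where k<L = ℕ.≰⇒> L≰k

3≤3+ : ∀ t → 3 ≤ suc (suc (suc t))
3≤3+ t = s≤s (s≤s (s≤s z≤n))

entry-diag : ∀ L k → 1 ≤ k → entry L k k ≡ true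
entry-diag L (suc zero)                _ = refl
entry-diag L (suc (suc zero))          _ = refl
entry-diag L k@(suc (suc (suc t))) _ with columnKind L k (3≤3+ t)
... | trailing _ shape  = trans (shape k) (comb-diag (L ∸ 2) k)
... | evenCol _ _ shape = trans (shape k) (comb-diag (k ∸ 1) k)
... | oddCol _ _ shape  = trans (shape k) (fan-diag k)

entry-below : ∀ L {k x} → 1 ≤ k → k < x → entry L x k ≡ false
entry-below L {suc zero}                _ k<x = ≢⇒≡ᵇ-false (ℕ.>⇒≢ k<x)
entry-below L {suc (suc zero)}          _ k<x = ≢⇒≡ᵇ-false (ℕ.>⇒≢ k<x)
entry-below L {k@(suc (suc (suc t)))} {x} 1≤k k<x with columnKind L k (3≤3+ t)
... | trailing L≤k shape =
  trans (shape x) (comb-off (ℕ.≤-<-trans (ℕ.m∸n≤m L 2) (ℕ.≤-<-trans L≤k k<x)) (ℕ.>⇒≢ k<x))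
... | evenCol _ _ shape = trans (shape x) (comb-off (ℕ.≤-<-trans (ℕ.n≤1+n _) k<x) (ℕ.>⇒≢ k<x))
... | oddCol _ _ shape  = trans (shape x) (fan-below 1≤k k<x)

entry-column-sum : ∀ L k → 3 ≤ L → even L ≡ false → 1 ≤ k →
  sumTo k (λ x → weight L x * b2z (entry L x k)) ≡ 1ℤ
entry-column-sum L (suc zero) 3≤L _ _
  rewrite weight-below {L} {1} (ℕ.≤-trans (s≤s (s≤s z≤n)) 3≤L) = refl
entry-column-sum L (suc (suc zero)) 3≤L _ _
  rewrite weight-below {L} {1} (ℕ.≤-trans (s≤s (s≤s z≤n)) 3≤L) | weight-below {L} {2} 3≤L = refl
entry-column-sum L k@(suc (suc (suc t))) 3≤L L-odd _ with columnKind L k (3≤3+ t)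
... | trailing L≤k shape = begin
  sumTo k (λ x → weight L x * b2z (entry L x k))      ≡⟨ sumTo-cong k (λ x _ _ → cong (λ e → weight L x * b2z e) (shape x)) ⟩
  sumTo k (λ x → weight L x * b2z (comb (L ∸ 2) k x)) ≡⟨ comb-column-sum (weight L) (L ∸ 2) k L-2-odd (ℕ.<-≤-trans L-2<L L≤k)
                                                          (λ x _ x≤L-2 → weight-below (ℕ.≤-<-trans x≤L-2 L-2<L)) (weight-from L≤k) ⟩
  1ℤ                                                   ∎
  where
  L-2<L : L ∸ 2 < L
  L-2<L = ℕ.∸-monoʳ-< z<s (ℕ.≤-trans (s≤s (s≤s z≤n)) 3≤L)
  L-2-odd : even (L ∸ 2) ≡ false
  L-2-odd = trans (even-∸2 (ℕ.≤-trans (s≤s (s≤s z≤n)) 3≤L)) L-odd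
... | evenCol k<L k-even shape = begin
  sumTo k (λ x → weight L x * b2z (entry L x k))      ≡⟨ sumTo-cong k (λ x _ _ → cong (λ e → weight L x * b2z e) (shape x)) ⟩
  sumTo k (λ x → weight L x * b2z (comb (k ∸ 1) k x)) ≡⟨ comb-column-sum (weight L) (k ∸ 1) k (even-suc-inv (k ∸ 1) k-even) ℕ.≤-refl
                                                          (λ x _ x≤k-1 → weight-below (ℕ.<-trans (s≤s x≤k-1) k<L))
                                                          (trans (weight-below k<L) (if-true k-even)) ⟩
  1ℤ                                                   ∎
... | oddCol k<L k-odd shape = begin
  sumTo k (λ x → weight L x * b2z (entry L x k))      ≡⟨ sumTo-cong k (λ x _ _ → cong (λ e → weight L x * b2z e) (shape x)) ⟩
  sumTo k (λ x → weight L x * b2z (fan k x))          ≡⟨ fan-column-sum (weight L) k (3≤3+ t) k-odd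
                                                          (λ x _ x<k → weight-below (ℕ.<-trans x<k k<L))
                                                          (trans (weight-below k<L) (if-false k-odd)) ⟩
  1ℤ                                                   ∎

HasPattern : ∀ {N} → ℕ → Matrix N → Set
HasPattern L C = ∀ i k → C i k ≡ b2z (entry L (suc (toℕ i)) (suc (toℕ k)))

pattern-unitriangular : ∀ {N} L (C : Matrix N) → HasPattern L C → UpperUnitriangular C
pattern-unitriangular L C pat =
  (λ i → trans (pat i i) (cong b2z (entry-diag L (suc (toℕ i)) (s≤s z≤n)))) ,
  (λ i j j<i → trans (pat i j) (cong b2z (entry-below L (s≤s z≤n) (s≤s j<i))))

pattern-weights : ∀ {N} L (C : Matrix N) → 3 ≤ L → even L ≡ false → HasPattern L C →
  ∀ k → ((λ j → weight L (suc (toℕ j))) ᵀ⊗ C) k ≡ 1ℤ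
pattern-weights {N} L C 3≤L L-odd pat k = begin
  Σℤ N (λ j → weight L (suc (toℕ j)) * C j k) ≡⟨ Σ-cong N (λ j → cong (weight L (suc (toℕ j)) *_) (pat j k)) ⟩
  Σℤ N (λ j → column (suc (toℕ j)))          ≡⟨ Σℤ≡sumTo N column ⟩
  sumTo N column                              ≡⟨ sumTo-truncate column (toℕ<n k) below-diagonal ⟩
  sumTo K column                              ≡⟨ entry-column-sum L K 3≤L L-odd (s≤s z≤n) ⟩
  1ℤ                                          ∎
  where
  K : ℕ
  K = suc (toℕ k)
  column : ℕ → ℤ
  column x = weight L x * b2z (entry L x K)
  below-diagonal : ∀ x → K < x → x ≤ N → column x ≡ 0ℤ
  below-diagonal x K<x _ = trans (cong (λ e → weight L x * b2z e) (entry-below L (s≤s z≤n) K<x)) (*-zeroʳ (weight L x))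

pattern-inverse : ∀ {N} L (C : Matrix N) → 3 ≤ L → even L ≡ false → HasPattern L C →
  (∃ λ D → IsInverse C D) × (∀ D → IsInverse C D → ∀ k → colSum D k ≡ weight L (suc (toℕ k)))
pattern-inverse {N} L C 3≤L L-odd pat =
  unitriangular-invertible N C (pattern-unitriangular L C pat) ,
  λ D inverse → colSum-right-inverse C D _ (proj₁ inverse) (pattern-weights L C 3≤L L-odd pat)

c₁-entry : ∀ {L} x k → 1 ≤ k → k ≤ L → c₁ (suc L) x k ≡ entry L x k
c₁-entry x (suc zero)                _ _   = refl
c₁-entry x (suc (suc zero))          _ _   = refl
c₁-entry {L} x k@(suc (suc (suc t))) _ k≤L with columnKind L k (3≤3+ t)
... | trailing L≤k shape = begin
  c₁ (suc L) x k      ≡⟨ if-true (≡⇒≡ᵇ-true k≡L) ⟩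
  comb (L ∸ 2) L x    ≡⟨ cong (λ z → comb (L ∸ 2) z x) (sym k≡L) ⟩
  comb (L ∸ 2) k x    ≡⟨ sym (shape x) ⟩
  entry L x k         ∎
  where
  k≡L : k ≡ L
  k≡L = ℕ.≤-antisym k≤L L≤k
... | evenCol k<L k-even shape =
  trans (if-false (≢⇒≡ᵇ-false (ℕ.<⇒≢ k<L))) (trans (if-false (cong not k-even)) (sym (shape x)))
... | oddCol k<L k-odd shape =
  trans (if-false (≢⇒≡ᵇ-false (ℕ.<⇒≢ k<L))) (trans (if-true (cong not k-odd)) (sym (shape x)))

c₂-entry : ∀ {L} x k → 1 ≤ k → k ≤ suc L → c₂ (suc (suc L)) x k ≡ entry L x k
c₂-entry x (suc zero)                _ _    = refl
c₂-entry x (suc (suc zero))          _ _    = refl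
c₂-entry {L} x k@(suc (suc (suc t))) _ k≤L+1 with columnKind L k (3≤3+ t)
... | trailing L≤k shape with ℕ.m≤n⇒m<n∨m≡n L≤k
...   | inj₂ L≡k = begin
  c₂ (suc (suc L)) x k ≡⟨ if-true (≡⇒≡ᵇ-true (sym L≡k)) ⟩
  comb (L ∸ 2) L x     ≡⟨ cong (λ z → comb (L ∸ 2) z x) L≡k ⟩
  comb (L ∸ 2) k x     ≡⟨ sym (shape x) ⟩
  entry L x k          ∎
...   | inj₁ L<k = begin
  c₂ (suc (suc L)) x k   ≡⟨ if-false (≢⇒≡ᵇ-false (ℕ.>⇒≢ L<k)) ⟩
  _                      ≡⟨ if-true (≡⇒≡ᵇ-true k≡L+1) ⟩
  comb (L ∸ 2) (suc L) x ≡⟨ cong (λ z → comb (L ∸ 2) z x) (sym k≡L+1) ⟩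
  comb (L ∸ 2) k x       ≡⟨ sym (shape x) ⟩
  entry L x k            ∎
  where
  k≡L+1 : k ≡ suc L
  k≡L+1 = ℕ.≤-antisym k≤L+1 L<k
c₂-entry {L} x k@(suc (suc (suc t))) _ k≤L+1 | evenCol k<L k-even shape =
  trans (if-false (≢⇒≡ᵇ-false (ℕ.<⇒≢ k<L)))
    (trans (if-false (≢⇒≡ᵇ-false (ℕ.<⇒≢ (ℕ.m<n⇒m<1+n k<L)))) (trans (if-false (cong not k-even)) (sym (shape x))))
c₂-entry {L} x k@(suc (suc (suc t))) _ k≤L+1 | oddCol k<L k-odd shape =
  trans (if-false (≢⇒≡ᵇ-false (ℕ.<⇒≢ k<L)))
    (trans (if-false (≢⇒≡ᵇ-false (ℕ.<⇒≢ (ℕ.m<n⇒m<1+n k<L)))) (trans (if-true (cong not k-odd)) (sym (shape x))))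

weight-odd : ∀ {L t} → 3 ≤ suc t → suc t < L → ¬ (2 ∣ suc t) → weight L (suc t) ≡ - (+ fib t)
weight-odd {t = suc t} (s≤s (s≤s _)) k<L 2∤k = trans (weight-below k<L) (if-false (dec-false (2 ∣? suc (suc t)) 2∤k))

weight-even : ∀ {L t} → 2 ≤ suc t → suc t < L → 2 ∣ suc t → weight L (suc t) ≡ + fib t
weight-even {t = suc t} (s≤s (s≤s _)) k<L 2∣k = trans (weight-below k<L) (if-true (dec-true (2 ∣? suc (suc t)) 2∣k))

≤∸suc⇒< : ∀ {m L} d → suc d ≤ L → m ≤ L ∸ suc d → m < L
≤∸suc⇒< d d<L m≤ = ℕ.≤-<-trans m≤ (ℕ.∸-monoʳ-< z<s d<L)

C₁-theorem : ∀ (n : ℕ) → 2 ∣ n → 6 ≤ n →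
  (∃ λ D → IsInverse (C₁ n) D) ×
  (∀ D → IsInverse (C₁ n) D → ∀ (k : Fin (n ∸ 1)) →
    (suc (toℕ k) ≡ 1 → colSum D k ≡ 1ℤ) ×
    (suc (toℕ k) ≡ 2 → colSum D k ≡ 1ℤ) ×
    (¬ (2 ∣ suc (toℕ k)) → 3 ≤ suc (toℕ k) → suc (toℕ k) ≤ n ∸ 3 → colSum D k ≡ - (+ fib (toℕ k))) ×
    (2 ∣ suc (toℕ k) → 4 ≤ suc (toℕ k) → suc (toℕ k) ≤ n ∸ 2 → colSum D k ≡ + fib (toℕ k)) ×
    (suc (toℕ k) ≡ n ∸ 1 → colSum D k ≡ + fib (n ∸ 3)))
C₁-theorem (suc L) 2∣n (s≤s 5≤L) = proj₁ inverse , columns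
  where
  3≤L : 3 ≤ L
  3≤L = ℕ.≤-trans (s≤s (s≤s (s≤s z≤n))) 5≤L
  inverse = pattern-inverse L (C₁ (suc L)) 3≤L (even-suc-inv L (dec-true (2 ∣? suc L) 2∣n))
              (λ i k → cong b2z (c₁-entry (suc (toℕ i)) (suc (toℕ k)) (s≤s z≤n) (toℕ<n k)))
  columns : ∀ D → IsInverse (C₁ (suc L)) D → ∀ k → _
  columns D inv k =
    (λ K≡1 → trans sum (trans (cong (weight L) K≡1) (weight-below (ℕ.≤-trans (s≤s (s≤s z≤n)) 3≤L)))) ,
    (λ K≡2 → trans sum (trans (cong (weight L) K≡2) (weight-below 3≤L))) ,
    (λ 2∤K 3≤K K≤L-2 → trans sum (weight-odd 3≤K (≤∸suc⇒< 1 (ℕ.≤-trans (s≤s (s≤s z≤n)) 3≤L) K≤L-2) 2∤K)) ,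
    (λ 2∣K 4≤K K≤L-1 → trans sum (weight-even (ℕ.≤-trans (s≤s (s≤s z≤n)) 4≤K)
                                    (≤∸suc⇒< 0 (ℕ.≤-trans (s≤s z≤n) 3≤L) K≤L-1) 2∣K)) ,
    (λ K≡L → trans sum (trans (cong (weight L) K≡L) (weight-from {L} ℕ.≤-refl)))
    where
    sum : colSum D k ≡ weight L (suc (toℕ k))
    sum = proj₂ inverse D inv k

C₂-theorem : ∀ (n : ℕ) → ¬ (2 ∣ n) → 7 ≤ n →
  (∃ λ D → IsInverse (C₂ n) D) ×
  (∀ D → IsInverse (C₂ n) D → ∀ (k : Fin (n ∸ 1)) →
    (suc (toℕ k) ≡ 1 → colSum D k ≡ 1ℤ) ×
    (suc (toℕ k) ≡ 2 → colSum D k ≡ 1ℤ) ×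
    (¬ (2 ∣ suc (toℕ k)) → 3 ≤ suc (toℕ k) → suc (toℕ k) ≤ n ∸ 4 → colSum D k ≡ - (+ fib (toℕ k))) ×
    (2 ∣ suc (toℕ k) → 4 ≤ suc (toℕ k) → suc (toℕ k) ≤ n ∸ 3 → colSum D k ≡ + fib (toℕ k)) ×
    (suc (toℕ k) ≡ n ∸ 2 → colSum D k ≡ + fib (n ∸ 4)) ×
    (suc (toℕ k) ≡ n ∸ 1 → colSum D k ≡ + fib (n ∸ 4)))
C₂-theorem (suc (suc L)) 2∤n (s≤s (s≤s 5≤L)) = proj₁ inverse , columns
  where
  3≤L : 3 ≤ L
  3≤L = ℕ.≤-trans (s≤s (s≤s (s≤s z≤n))) 5≤L
  inverse = pattern-inverse L (C₂ (suc (suc L))) 3≤L (trans (sym (even-suc-suc L)) (dec-false (2 ∣? suc (suc L)) 2∤n))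
              (λ i k → cong b2z (c₂-entry (suc (toℕ i)) (suc (toℕ k)) (s≤s z≤n) (toℕ<n k)))
  columns : ∀ D → IsInverse (C₂ (suc (suc L))) D → ∀ k → _
  columns D inv k =
    (λ K≡1 → trans sum (trans (cong (weight L) K≡1) (weight-below (ℕ.≤-trans (s≤s (s≤s z≤n)) 3≤L)))) ,
    (λ K≡2 → trans sum (trans (cong (weight L) K≡2) (weight-below 3≤L))) ,
    (λ 2∤K 3≤K K≤L-2 → trans sum (weight-odd 3≤K (≤∸suc⇒< 1 (ℕ.≤-trans (s≤s (s≤s z≤n)) 3≤L) K≤L-2) 2∤K)) ,
    (λ 2∣K 4≤K K≤L-1 → trans sum (weight-even (ℕ.≤-trans (s≤s (s≤s z≤n)) 4≤K)
                                    (≤∸suc⇒< 0 (ℕ.≤-trans (s≤s z≤n) 3≤L) K≤L-1) 2∣K)) ,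
    (λ K≡L → trans sum (trans (cong (weight L) K≡L) (weight-from {L} ℕ.≤-refl))) ,
    (λ K≡L+1 → trans sum (trans (cong (weight L) K≡L+1) (weight-from {L} (ℕ.n≤1+n L))))
    where
    sum : colSum D k ≡ weight L (suc (toℕ k))
    sum = proj₂ inverse D inv k

lemma2p5 :
    (∀ (n : ℕ) → 2 ∣ n → 6 ≤ n →
      (∃ λ D → IsInverse (C₁ n) D) ×
      (∀ D → IsInverse (C₁ n) D → ∀ (k : Fin (n ∸ 1)) →
        (suc (toℕ k) ≡ 1 → colSum D k ≡ 1ℤ) ×
        (suc (toℕ k) ≡ 2 → colSum D k ≡ 1ℤ) ×
        (¬ (2 ∣ suc (toℕ k)) → 3 ≤ suc (toℕ k) → suc (toℕ k) ≤ n ∸ 3 → colSum D k ≡ - (+ fib (toℕ k))) ×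
        (2 ∣ suc (toℕ k) → 4 ≤ suc (toℕ k) → suc (toℕ k) ≤ n ∸ 2 → colSum D k ≡ + fib (toℕ k)) ×
        (suc (toℕ k) ≡ n ∸ 1 → colSum D k ≡ + fib (n ∸ 3))))
    ×
    (∀ (n : ℕ) → ¬ (2 ∣ n) → 7 ≤ n →
      (∃ λ D → IsInverse (C₂ n) D) ×
      (∀ D → IsInverse (C₂ n) D → ∀ (k : Fin (n ∸ 1)) →
        (suc (toℕ k) ≡ 1 → colSum D k ≡ 1ℤ) ×
        (suc (toℕ k) ≡ 2 → colSum D k ≡ 1ℤ) ×
        (¬ (2 ∣ suc (toℕ k)) → 3 ≤ suc (toℕ k) → suc (toℕ k) ≤ n ∸ 4 → colSum D k ≡ - (+ fib (toℕ k))) ×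
        (2 ∣ suc (toℕ k) → 4 ≤ suc (toℕ k) → suc (toℕ k) ≤ n ∸ 3 → colSum D k ≡ + fib (toℕ k)) ×
        (suc (toℕ k) ≡ n ∸ 2 → colSum D k ≡ + fib (n ∸ 4)) ×
        (suc (toℕ k) ≡ n ∸ 1 → colSum D k ≡ + fib (n ∸ 4))))
lemma2p5 = C₁-theorem , C₂-theorem
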